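{- If $\mathcal C$ is an inductively pierced code, then its polar complex $\Gamma(\mathcal C)$ is shellable.
   Context: A neural code on $n$ neurons is a set $\mathcal C\subseteq 2^{[n]}$. The polar complex $\Gamma(\mathcal C)$ is the simplicial complex on vertex set $\{1,\dots,n,\bar1,\dots,\bar n\}$ whose facets are the sets $\{i:i\in c\}\cup\{\bar j: j\in[n]\setminus c\}$ for $c\in\mathcal C$ (it is pure of dimension $n-1$). A pure $d$-dimensional simplicial complex is shellable if its facets can be ordered $F_1,\dots,F_m$ so that for each $2\le k\le m$ the complex $\left(\bigcup_{i<k}F_i\right)\cap F_k$ (with facets viewed as full simplices) is pure of dimension $d-1$. Piercing: let $\mathcal C$ be a code on $[n]$ and $(\lambda,\sigma,\tau)$ a partition of $[n]$ into three disjoint (possibly empty) sets with $|\lambda|=j$. $\mathcal C$ is $(\lambda,\sigma,\tau)$-pierceable if $\sigma\cup\nu\in\mathcal C$ for every $\nu\subseteq\lambda$; then the $j$-piercing is the code on $[n+1]$ given by $\mathcal C\cup\{\sigma\cup\nu\cup\{n+1\}:\nu\subseteq\lambda\}$. A code is inductively $k$-pierced if it is $\{\varnothing,\{1\}\}$ or is obtained from an inductively $k$-pierced code on $n-1$ neurons by a $j$-piercing with $j\le k$. A code is inductively pierced if it is inductively $k$-pierced for some $k\ge0$. -}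

module Defs where

open import Data.Nat using (ℕ; zero; suc; _+_; _≤_)
open import Data.Bool using (Bool; true; false)
open import Data.Fin using (Fin)
open import Data.Fin.Subset using (Subset; _∩_; _∪_; _⊆_; ∁; ∣_∣; ⊤; ⊥)
open import Data.Vec using (Vec; []; _∷_; _++_; _∷ʳ_)
open import Data.List using (List; []; _∷_; map; [_])
open import Data.List.Membership.Propositional renaming (_∈_ to _∈ₗ_)
open import Data.List.Relation.Unary.Unique.Propositional using (Unique)
open import Data.Product using (Σ; ∃; _×_; _,_)
open import Data.Sum using (_⊎_)
open import Function.Bundles using (_⇔_)
open import Relation.Binary.PropositionalEquality using (_≡_)

-- A code on n neurons: a finite set of codewords, represented as a list
-- (only membership matters; duplicates are irrelevant).
Code : ℕ → Set
Code n = List (Subset n)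

-- Vertex set of the polar complex: Fin (n + n); vertex i is `inject i`
-- (first block), vertex ī is `raise n i` (second block).
-- Facet of Γ(C) associated to codeword c: {i : i ∈ c} ∪ {ī : i ∉ c}.
polarFacet : ∀ {n} → Subset n → Subset (n + n)
polarFacet c = c ++ ∁ c

polarFacets : ∀ {n} → Code n → List (Subset (n + n))
polarFacets C = map polarFacet C

-- Shellability of the pure simplicial complex whose facets are (the members of)
-- Fs, all facets having r vertices (dimension d = r - 1).
-- An ordering L lists every facet exactly once; for every k ≥ 2, writing
-- L = A ++ F ∷ B with A = [F_1..F_{k-1}] nonempty and F = F_k, the complex
-- generated by {G ∩ F : G ∈ A} is pure of dimension d - 1, i.e. each of its
-- facets (maximal members G ∩ F) has exactly r - 1 = d vertices.
Shellable : ∀ {V} (r : ℕ) → List (Subset V) → Set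
Shellable {V} r Fs =
  Σ (List (Subset V)) λ L →
    Unique L
    × (∀ F → (F ∈ₗ L) ⇔ (F ∈ₗ Fs))
    × (∀ F → F ∈ₗ L → ∣ F ∣ ≡ r)
    × (∀ A F B → L ≡ A Data.List.++ (F ∷ B) →
         ∀ G → G ∈ₗ A →
         (∀ H → H ∈ₗ A → (G ∩ F) ⊆ (H ∩ F) → (H ∩ F) ⊆ (G ∩ F)) →
         ∣ G ∩ F ∣ + 1 ≡ r)

IsPartition3 : ∀ {n} → Subset n → Subset n → Subset n → Set
IsPartition3 l s t = (l ∩ s ≡ ⊥) × (l ∩ t ≡ ⊥) × (s ∩ t ≡ ⊥) × (l ∪ s ∪ t ≡ ⊤)

Pierceable : ∀ {n} → Code n → Subset n → Subset n → Set
Pierceable C l s = ∀ ν → ν ⊆ l → (s ∪ ν) ∈ₗ C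

-- D (a code on n+1 neurons; the new neuron n+1 is the last coordinate) equals,
-- as a set, the piercing C ∪ {σ ∪ ν ∪ {n+1} : ν ⊆ λ}.
IsPiercingOf : ∀ {n} → Code (suc n) → Code n → Subset n → Subset n → Set
IsPiercingOf {n} D C l s =
  ∀ d → (d ∈ₗ D) ⇔ ((Σ (Subset n) λ c → (c ∈ₗ C) × (d ≡ c ∷ʳ false))
                    ⊎ (Σ (Subset n) λ ν → (ν ⊆ l) × (d ≡ (s ∪ ν) ∷ʳ true)))

data IndPierced (k : ℕ) : (n : ℕ) → Code n → Set where
  base : ∀ (C : Code 1) →
         (∀ c → (c ∈ₗ C) ⇔ (c ∈ₗ ((false ∷ []) ∷ (true ∷ []) ∷ []))) →
         IndPierced k 1 C
  step : ∀ {n} (C : Code n) (D : Code (suc n)) (l s t : Subset n) →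
         IndPierced k n C →
         IsPartition3 l s t →
         ∣ l ∣ ≤ k →
         Pierceable C l s →
         IsPiercingOf D C l s →
         IndPierced k (suc n) D

InductivelyPierced : ∀ {n} → Code n → Set
InductivelyPierced {n} C = ∃ λ k → IndPierced k n C

-- Order the codewords so that, for each codeword c and each earlier codeword a, some earlier
-- codeword b is c with one coordinate flipped in which a and c differ.  Then
-- Γ(a) ∩ Γ(c) ⊆ Γ(b) ∩ Γ(c), and the latter is a ridge of Γ(c), so every maximal
-- Γ(a) ∩ Γ(c) is a ridge: the order is a shelling.  A subcube {σ ∪ ν : ν ⊆ λ} has such an
-- order (along a free coordinate, first the half where it is off, then the half where it is
-- on), and a piercing preserves it: list the old code with the new neuron off, then the
-- pierced subcube with it on; a new codeword σ ∪ ν ∪ {n+1} is adjacent to σ ∪ ν, an old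
-- codeword by pierceability.
module Submission where

open import Defs
open import Data.Nat using (ℕ; suc; _+_)
open import Data.Nat.Properties using (+-comm; +-suc; m+[n∸m]≡n)
open import Data.Bool using (true; false; not; _∧_)
open import Data.Bool.Properties using (∨-identityʳ)
open import Data.Fin.Subset using (Subset; _∩_; _∪_; _⊆_; ∁; ∣_∣; ⊤; ⊥)
open import Data.Fin.Subset.Properties
  using (⊆-refl; ⊆-reflexive; ⊆-trans; ⊆-antisym; drop-∷-⊆; out⊆; in⊆in; s⊆s;
         p∩q⊆q; ∩-idem; ∣p∣≤n; ∣∁p∣≡n∸∣p∣)
open import Data.Vec as Vec using ([]; _∷_; _∷ʳ_)
open import Data.Vec.Properties using (zipWith-++; ++-injectiveˡ; ∷-injectiveʳ; ∷ʳ-injectiveˡ; ∷ʳ-injectiveʳ)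
open import Data.List using (List; []; _∷_; map; _++_; [_])
import Data.List.Properties as ListProps
open import Data.List.Membership.Propositional using (_∈_)
open import Data.List.Membership.Propositional.Properties using (∈-map⁺; ∈-map⁻; ∈-++⁻; ∈-++⁺ˡ; ∈-++⁺ʳ)
open import Data.List.Relation.Unary.Any using (here)
open import Data.List.Relation.Unary.Unique.Propositional using (Unique; []; _∷_)
import Data.List.Relation.Unary.All as All
import Data.List.Relation.Unary.Unique.Propositional.Properties as Unique
open import Data.List.Relation.Binary.Disjoint.Propositional using (Disjoint)
open import Data.List.Relation.Binary.BagAndSetEquality using (_∼[_]_; set; map-cong)
open import Data.Product using (∃-syntax; _×_; _,_)
open import Data.Sum using (_⊎_; inj₁; inj₂)
open import Function.Bundles using (mk⇔; Equivalence)
import Function.Properties.Equivalence as ⇔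
open import Relation.Binary.PropositionalEquality using (_≡_; refl; sym; trans; cong; subst)

private
  variable
    A B : Set
    n : ℕ

map-≡-++-∷⁻ : ∀ (f : A → B) L {P′ c′ S′} → map f L ≡ P′ ++ c′ ∷ S′ →
              ∃[ P ] ∃[ c ] ∃[ S ] L ≡ P ++ c ∷ S × P′ ≡ map f P × c′ ≡ f c
map-≡-++-∷⁻ f [] {[]} ()
map-≡-++-∷⁻ f [] {_ ∷ _} ()
map-≡-++-∷⁻ f (x ∷ L) {[]} refl = [] , x , L , refl , refl , refl
map-≡-++-∷⁻ f (x ∷ L) {_ ∷ P′} eq with ListProps.∷-injective eq
... | refl , eq′ with map-≡-++-∷⁻ f L eq′
...   | P , c , S , refl , refl , refl = x ∷ P , c , S , refl , refl , refl

++-≡-++-∷⁻ : ∀ (X : List A) {Y P c S} → X ++ Y ≡ P ++ c ∷ S →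
             (∃[ S₁ ] X ≡ P ++ c ∷ S₁) ⊎ (∃[ P₂ ] P ≡ X ++ P₂ × Y ≡ P₂ ++ c ∷ S)
++-≡-++-∷⁻ [] {P = P} eq = inj₂ (P , refl , eq)
++-≡-++-∷⁻ (x ∷ X) {P = []} refl = inj₁ (X , refl)
++-≡-++-∷⁻ (x ∷ X) {P = _ ∷ P} eq with ListProps.∷-injective eq
... | refl , eq′ with ++-≡-++-∷⁻ X eq′
...   | inj₁ (S₁ , refl) = inj₁ (S₁ , refl)
...   | inj₂ (P₂ , refl , Y≡) = inj₂ (P₂ , refl , Y≡)

∣p++q∣≡∣p∣+∣q∣ : ∀ {m} (p : Subset n) (q : Subset m) → ∣ p Vec.++ q ∣ ≡ ∣ p ∣ + ∣ q ∣
∣p++q∣≡∣p∣+∣q∣ [] q = refl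
∣p++q∣≡∣p∣+∣q∣ (false ∷ p) q = ∣p++q∣≡∣p∣+∣q∣ p q
∣p++q∣≡∣p∣+∣q∣ (true ∷ p) q = cong suc (∣p++q∣≡∣p∣+∣q∣ p q)

∣p∣+∣∁p∣≡n : ∀ (p : Subset n) → ∣ p ∣ + ∣ ∁ p ∣ ≡ n
∣p∣+∣∁p∣≡n p rewrite ∣∁p∣≡n∸∣p∣ p = m+[n∸m]≡n (∣p∣≤n p)

++-mono-⊆ : ∀ {m} {p q : Subset n} {p′ q′ : Subset m} → p ⊆ q → p′ ⊆ q′ → p Vec.++ p′ ⊆ q Vec.++ q′
++-mono-⊆ {p = []} {[]} _ p′⊆q′ = p′⊆q′
++-mono-⊆ {p = false ∷ p} {_ ∷ q} p⊆q p′⊆q′ = out⊆ (++-mono-⊆ (drop-∷-⊆ p⊆q) p′⊆q′)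
++-mono-⊆ {p = true ∷ p} {true ∷ q} p⊆q p′⊆q′ = in⊆in (++-mono-⊆ (drop-∷-⊆ p⊆q) p′⊆q′)
++-mono-⊆ {p = true ∷ p} {false ∷ q} p⊆q _ with p⊆q Vec.here
... | ()

Covers : (A → A → A → Set) → List A → A → Set
Covers R P c = ∀ {a} → a ∈ P → ∃[ b ] b ∈ P × R a b c

PrecededBy : (A → A → A → Set) → List A → Set
PrecededBy R L = ∀ P c S → L ≡ P ++ c ∷ S → Covers R P c

PrecededBy-[_] : ∀ {R : A → A → A → Set} x → PrecededBy R [ x ]
PrecededBy-[ x ] [] _ _ _ ()
PrecededBy-[ x ] (_ ∷ []) _ _ ()
PrecededBy-[ x ] (_ ∷ _ ∷ _) _ _ ()

PrecededBy-map : ∀ {R : A → A → A → Set} {R′ : B → B → B → Set} {L} (f : A → B) →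
                 (∀ {a b c} → R a b c → R′ (f a) (f b) (f c)) →
                 PrecededBy R L → PrecededBy R′ (map f L)
PrecededBy-map {L = L} f f-resp preceded P′ c′ S′ eq a′∈ with map-≡-++-∷⁻ f L eq
... | P , c , S , L≡ , refl , refl with ∈-map⁻ f a′∈
...   | a , a∈ , refl with preceded P c S L≡ a∈
...     | b , b∈ , Rabc = f b , ∈-map⁺ f b∈ , f-resp Rabc

PrecededBy-++ : ∀ {R : A → A → A → Set} {X Y} → PrecededBy R X → PrecededBy R Y →
                (∀ {c} → c ∈ Y → Covers R X c) → PrecededBy R (X ++ Y)
PrecededBy-++ {X = X} precededX precededY coverY P c S eq a∈ with ++-≡-++-∷⁻ X eq
... | inj₁ (S₁ , X≡) = precededX P c S₁ X≡ a∈
... | inj₂ (P₂ , refl , Y≡) with ∈-++⁻ X a∈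
...   | inj₁ a∈X = let b , b∈ , Rabc = coverY (subst (c ∈_) (sym Y≡) (∈-++⁺ʳ P₂ (here refl))) a∈X
                   in b , ∈-++⁺ˡ b∈ , Rabc
...   | inj₂ a∈P₂ = let b , b∈ , Rabc = precededY P₂ c S Y≡ a∈P₂ in b , ∈-++⁺ʳ X b∈ , Rabc

RidgeCover : ∀ {V} → ℕ → Subset V → Subset V → Subset V → Set
RidgeCover r G H F = G ∩ F ⊆ H ∩ F × ∣ H ∩ F ∣ + 1 ≡ r

shellable : ∀ {V} r {Fs L : List (Subset V)} → Unique L → L ∼[ set ] Fs → (∀ F → F ∈ L → ∣ F ∣ ≡ r) →
            PrecededBy (RidgeCover r) L → Shellable r Fs
shellable r {L = L} unique L≈Fs size preceded = L , unique , (λ F → L≈Fs {F}) , size , pure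
  where
  pure : ∀ P F S → L ≡ P ++ F ∷ S → ∀ G → G ∈ P →
         (∀ H → H ∈ P → G ∩ F ⊆ H ∩ F → H ∩ F ⊆ G ∩ F) → ∣ G ∩ F ∣ + 1 ≡ r
  pure P F S eq G G∈ maximal with preceded P F S eq G∈
  ... | H , H∈ , G∩F⊆H∩F , ∣H∩F∣+1≡r
    rewrite ⊆-antisym G∩F⊆H∩F (maximal H H∈ G∩F⊆H∩F) = ∣H∩F∣+1≡r

∣polarFacet∣ : ∀ (c : Subset n) → ∣ polarFacet c ∣ ≡ n
∣polarFacet∣ c = trans (∣p++q∣≡∣p∣+∣q∣ c (∁ c)) (∣p∣+∣∁p∣≡n c)

polarFacet-injective : ∀ {a c : Subset n} → polarFacet a ≡ polarFacet c → a ≡ c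
polarFacet-injective {a = a} {c} = ++-injectiveˡ a c

polarFacet-∩ : ∀ (a c : Subset n) → polarFacet a ∩ polarFacet c ≡ (a ∩ c) Vec.++ (∁ a ∩ ∁ c)
polarFacet-∩ a c = zipWith-++ _∧_ a (∁ a) c (∁ c)

-- b is c with a single coordinate flipped, one in which a and c differ.
data NeighbourTowards : Subset n → Subset n → Subset n → Set where
  flipHead : ∀ {as cs : Subset n} {x} → NeighbourTowards (not x ∷ as) (not x ∷ cs) (x ∷ cs)
  keepHead : ∀ {as bs cs : Subset n} {x y} →
             NeighbourTowards as bs cs → NeighbourTowards (y ∷ as) (x ∷ bs) (x ∷ cs)

neighbour-∁ : ∀ {a b c : Subset n} → NeighbourTowards a b c → NeighbourTowards (∁ a) (∁ b) (∁ c)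
neighbour-∁ flipHead = flipHead
neighbour-∁ (keepHead nb) = keepHead (neighbour-∁ nb)

neighbour-∩-⊆ : ∀ {a b c : Subset n} → NeighbourTowards a b c → a ∩ c ⊆ b ∩ c
neighbour-∩-⊆ (flipHead {as = as} {cs}) = s⊆s (⊆-trans (p∩q⊆q as cs) (⊆-reflexive (sym (∩-idem cs))))
neighbour-∩-⊆ (keepHead {x = x} {y} nb) = head-⊆ x y (neighbour-∩-⊆ nb)
  where
  head-⊆ : ∀ {m} {p q : Subset m} x y → p ⊆ q → (y ∧ x) ∷ p ⊆ (x ∧ x) ∷ q
  head-⊆ _     false = out⊆
  head-⊆ false true  = out⊆
  head-⊆ true  true  = in⊆in

self-agreements : ∀ (c : Subset n) → ∣ c ∩ c ∣ + ∣ ∁ c ∩ ∁ c ∣ ≡ n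
self-agreements c rewrite ∩-idem c | ∩-idem (∁ c) = ∣p∣+∣∁p∣≡n c

neighbour-agreements : ∀ {a b c : Subset n} → NeighbourTowards a b c → ∣ b ∩ c ∣ + ∣ ∁ b ∩ ∁ c ∣ + 1 ≡ n
neighbour-agreements (flipHead {cs = cs} {false}) = trans (cong (_+ 1) (self-agreements cs)) (+-comm _ 1)
neighbour-agreements (flipHead {cs = cs} {true}) = trans (cong (_+ 1) (self-agreements cs)) (+-comm _ 1)
neighbour-agreements (keepHead {x = false} nb) = trans (cong (_+ 1) (+-suc _ _)) (cong suc (neighbour-agreements nb))
neighbour-agreements (keepHead {x = true} nb) = cong suc (neighbour-agreements nb)

neighbour⇒ridgeCover : ∀ {a b c : Subset n} → NeighbourTowards a b c →
                       RidgeCover n (polarFacet a) (polarFacet b) (polarFacet c)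
neighbour⇒ridgeCover {a = a} {b} {c} nb
  rewrite polarFacet-∩ a c | polarFacet-∩ b c | ∣p++q∣≡∣p∣+∣q∣ (b ∩ c) (∁ b ∩ ∁ c) =
    ++-mono-⊆ (neighbour-∩-⊆ nb) (neighbour-∩-⊆ (neighbour-∁ nb)) , neighbour-agreements nb

neighbour-∷ʳ : ∀ {a b c : Subset n} x → NeighbourTowards a b c → NeighbourTowards (a ∷ʳ x) (b ∷ʳ x) (c ∷ʳ x)
neighbour-∷ʳ x flipHead = flipHead
neighbour-∷ʳ x (keepHead nb) = keepHead (neighbour-∷ʳ x nb)

neighbour-last : ∀ (a c : Subset n) x → NeighbourTowards (a ∷ʳ not x) (c ∷ʳ not x) (c ∷ʳ x)
neighbour-last [] [] x = flipHead
neighbour-last (_ ∷ a) (_ ∷ c) x = keepHead (neighbour-last a c x)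

PolarShellable : Code n → Set
PolarShellable {n} C =
  ∃[ L ] Unique L × L ∼[ set ] C × PrecededBy (NeighbourTowards {n}) L

polarShellable⇒shellable : ∀ {C : Code n} → PolarShellable C → Shellable n (polarFacets C)
polarShellable⇒shellable {n} (L , unique , L≈C , preceded) =
  shellable n (Unique.map⁺ polarFacet-injective unique) (map-cong (λ _ → refl) L≈C) size
    (PrecededBy-map polarFacet neighbour⇒ridgeCover preceded)
  where
  size : ∀ F → F ∈ map polarFacet L → ∣ F ∣ ≡ n
  size F F∈ with ∈-map⁻ polarFacet F∈
  ... | c , _ , refl = ∣polarFacet∣ c

subcube : Subset n → Subset n → List (Subset n)
subcube [] [] = [ [] ]
subcube (true ∷ l) (_ ∷ s) = map (false ∷_) (subcube l s) ++ map (true ∷_) (subcube l s)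
subcube (false ∷ l) (x ∷ s) = map (x ∷_) (subcube l s)

subcube-unique : ∀ (l s : Subset n) → Unique (subcube l s)
subcube-unique [] [] = All.[] ∷ []
subcube-unique (true ∷ l) (_ ∷ s) =
  Unique.++⁺ (Unique.map⁺ ∷-injectiveʳ (subcube-unique l s)) (Unique.map⁺ ∷-injectiveʳ (subcube-unique l s)) disjoint
  where
  disjoint : Disjoint (map (false ∷_) (subcube l s)) (map (true ∷_) (subcube l s))
  disjoint (v∈₀ , v∈₁) with ∈-map⁻ (false ∷_) v∈₀ | ∈-map⁻ (true ∷_) v∈₁
  ... | _ , _ , refl | _ , _ , ()
subcube-unique (false ∷ l) (_ ∷ s) = Unique.map⁺ ∷-injectiveʳ (subcube-unique l s)

∈-subcube⁻ : ∀ (l s : Subset n) {w} → l ∩ s ≡ ⊥ → w ∈ subcube l s → ∃[ ν ] ν ⊆ l × w ≡ s ∪ ν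
∈-subcube⁻ [] [] _ (here refl) = [] , ⊆-refl , refl
∈-subcube⁻ (true ∷ l) (true ∷ s) () _
∈-subcube⁻ (true ∷ l) (false ∷ s) disjoint w∈ with ∈-++⁻ (map (false ∷_) (subcube l s)) w∈
... | inj₁ w∈₀ with ∈-map⁻ (false ∷_) w∈₀
...   | v , v∈ , refl with ∈-subcube⁻ l s (∷-injectiveʳ disjoint) v∈
...     | ν , ν⊆l , refl = false ∷ ν , out⊆ ν⊆l , refl
∈-subcube⁻ (true ∷ l) (false ∷ s) disjoint w∈ | inj₂ w∈₁ with ∈-map⁻ (true ∷_) w∈₁
...   | v , v∈ , refl with ∈-subcube⁻ l s (∷-injectiveʳ disjoint) v∈
...     | ν , ν⊆l , refl = true ∷ ν , in⊆in ν⊆l , refl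
∈-subcube⁻ (false ∷ l) (x ∷ s) disjoint w∈ with ∈-map⁻ (x ∷_) w∈
... | v , v∈ , refl with ∈-subcube⁻ l s (∷-injectiveʳ disjoint) v∈
...   | ν , ν⊆l , refl = false ∷ ν , out⊆ ν⊆l , cong (_∷ s ∪ ν) (sym (∨-identityʳ x))

∈-subcube⁺ : ∀ (l s : Subset n) {ν} → l ∩ s ≡ ⊥ → ν ⊆ l → s ∪ ν ∈ subcube l s
∈-subcube⁺ [] [] {[]} _ _ = here refl
∈-subcube⁺ (true ∷ l) (true ∷ s) () _
∈-subcube⁺ (true ∷ l) (false ∷ s) {false ∷ ν} disjoint ν⊆l =
  ∈-++⁺ˡ (∈-map⁺ (false ∷_) (∈-subcube⁺ l s (∷-injectiveʳ disjoint) (drop-∷-⊆ ν⊆l)))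
∈-subcube⁺ (true ∷ l) (false ∷ s) {true ∷ ν} disjoint ν⊆l =
  ∈-++⁺ʳ _ (∈-map⁺ (true ∷_) (∈-subcube⁺ l s (∷-injectiveʳ disjoint) (drop-∷-⊆ ν⊆l)))
∈-subcube⁺ (false ∷ l) (x ∷ s) {false ∷ ν} disjoint ν⊆l rewrite ∨-identityʳ x =
  ∈-map⁺ (x ∷_) (∈-subcube⁺ l s (∷-injectiveʳ disjoint) (drop-∷-⊆ ν⊆l))
∈-subcube⁺ (false ∷ l) (x ∷ s) {true ∷ ν} _ ν⊆l with ν⊆l Vec.here
... | ()

subcube-precededBy : ∀ (l s : Subset n) → PrecededBy NeighbourTowards (subcube l s)
subcube-precededBy [] [] = PrecededBy-[ [] ]
subcube-precededBy (true ∷ l) (_ ∷ s) =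
  PrecededBy-++ (PrecededBy-map (false ∷_) keepHead (subcube-precededBy l s))
                (PrecededBy-map (true ∷_) keepHead (subcube-precededBy l s)) cover
  where
  cover : ∀ {c} → c ∈ map (true ∷_) (subcube l s) → Covers NeighbourTowards (map (false ∷_) (subcube l s)) c
  cover c∈ a∈ with ∈-map⁻ (true ∷_) c∈ | ∈-map⁻ (false ∷_) a∈
  ... | v , v∈ , refl | _ , _ , refl = false ∷ v , ∈-map⁺ (false ∷_) v∈ , flipHead
subcube-precededBy (false ∷ l) (x ∷ s) = PrecededBy-map (x ∷_) keepHead (subcube-precededBy l s)

piercingOrder : List (Subset n) → Subset n → Subset n → List (Subset (suc n))
piercingOrder L l s = map (_∷ʳ false) L ++ map (_∷ʳ true) (subcube l s)

piercingOrder-unique : ∀ {L : List (Subset n)} l s → Unique L → Unique (piercingOrder L l s)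
piercingOrder-unique {L = L} l s unique =
  Unique.++⁺ (Unique.map⁺ (∷ʳ-injectiveˡ _ _) unique) (Unique.map⁺ (∷ʳ-injectiveˡ _ _) (subcube-unique l s)) disjoint
  where
  disjoint : Disjoint (map (_∷ʳ false) L) (map (_∷ʳ true) (subcube l s))
  disjoint (v∈old , v∈new) with ∈-map⁻ (_∷ʳ false) v∈old | ∈-map⁻ (_∷ʳ true) v∈new
  ... | c , _ , refl | w , _ , c∷ʳfalse≡w∷ʳtrue with ∷ʳ-injectiveʳ c w c∷ʳfalse≡w∷ʳtrue
  ... | ()

piercingOrder-∼ : ∀ {L C : Code n} {D l s} → l ∩ s ≡ ⊥ → L ∼[ set ] C → IsPiercingOf D C l s →
                  piercingOrder L l s ∼[ set ] D
piercingOrder-∼ {L = L} {D = D} {l = l} {s = s} disjoint L≈C D≈ {d} = mk⇔ to from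
  where
  to : d ∈ piercingOrder L l s → d ∈ D
  to d∈ with ∈-++⁻ (map (_∷ʳ false) L) d∈
  ... | inj₁ d∈old with ∈-map⁻ (_∷ʳ false) d∈old
  ...   | c , c∈ , d≡ = Equivalence.from (D≈ d) (inj₁ (c , Equivalence.to L≈C c∈ , d≡))
  to d∈ | inj₂ d∈new with ∈-map⁻ (_∷ʳ true) d∈new
  ...   | w , w∈ , d≡ with ∈-subcube⁻ l s disjoint w∈
  ...     | ν , ν⊆l , refl = Equivalence.from (D≈ d) (inj₂ (ν , ν⊆l , d≡))
  from : d ∈ D → d ∈ piercingOrder L l s
  from d∈ with Equivalence.to (D≈ d) d∈
  ... | inj₁ (c , c∈ , refl) = ∈-++⁺ˡ (∈-map⁺ (_∷ʳ false) (Equivalence.from L≈C c∈))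
  ... | inj₂ (ν , ν⊆l , refl) = ∈-++⁺ʳ _ (∈-map⁺ (_∷ʳ true) (∈-subcube⁺ l s disjoint ν⊆l))

piercingOrder-precededBy : ∀ {L C : Code n} {l s} → l ∩ s ≡ ⊥ → Pierceable C l s → L ∼[ set ] C →
                           PrecededBy NeighbourTowards L → PrecededBy NeighbourTowards (piercingOrder L l s)
piercingOrder-precededBy {L = L} {l = l} {s = s} disjoint pierceable L≈C preceded =
  PrecededBy-++ (PrecededBy-map (_∷ʳ false) (neighbour-∷ʳ false) preceded)
                (PrecededBy-map (_∷ʳ true) (neighbour-∷ʳ true) (subcube-precededBy l s)) cover
  where
  cover : ∀ {c} → c ∈ map (_∷ʳ true) (subcube l s) → Covers NeighbourTowards (map (_∷ʳ false) L) c
  cover c∈ a∈ with ∈-map⁻ (_∷ʳ true) c∈ | ∈-map⁻ (_∷ʳ false) a∈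
  ... | w , w∈ , refl | a , _ , refl with ∈-subcube⁻ l s disjoint w∈
  ...   | ν , ν⊆l , refl =
    (s ∪ ν) ∷ʳ false , ∈-map⁺ (_∷ʳ false) (Equivalence.from L≈C (pierceable ν ν⊆l)) , neighbour-last a (s ∪ ν) true

-- For n = 1, subcube ⊤ ⊥ reduces to the list ∅, {1}.
indPierced⇒polarShellable : ∀ {k} {C : Code n} → IndPierced k n C → PolarShellable C
indPierced⇒polarShellable (base _ C≈) =
  subcube ⊤ ⊥ , subcube-unique ⊤ ⊥ , (λ {c} → ⇔.sym (C≈ c)) , subcube-precededBy ⊤ ⊥
indPierced⇒polarShellable (step _ _ l s _ pierced (l∩s≡⊥ , _) _ pierceable piercing)
  with indPierced⇒polarShellable pierced
... | L , unique , L≈C , preceded =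
  piercingOrder L l s , piercingOrder-unique l s unique , piercingOrder-∼ l∩s≡⊥ L≈C piercing ,
  piercingOrder-precededBy l∩s≡⊥ pierceable L≈C preceded

theorem3p8 : ∀ (n : ℕ) (C : Code n) → InductivelyPierced C → Shellable n (polarFacets C)
theorem3p8 n C (_ , pierced) = polarShellable⇒shellable (indPierced⇒polarShellable pierced)
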